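{- Let $Q$ be the $3\times 3$ permutation matrix with $1$-entries exactly at positions $(1,1),(2,3),(3,2)$ (the permutation $132$). Then for every integer $n\ge 3$, $\mathrm{M}(n,Q)\le n^2-3n+3$.
   Context: All matrices are $(0,1)$-matrices. An $n\times n$ matrix $A$ is strongly $Q$-forcing if for every $1$-entry $o$ of $A$ there is a $3\times 3$ submatrix of $A$ (any $3$ rows and any $3$ columns, order kept) exactly equal to $Q$ that contains $o$. $\mathrm{M}(n,Q)$ is the maximum number of $1$-entries of an $n\times n$ strongly $Q$-forcing matrix (defined for $n\ge 3$). -}

module Defs where

open import Data.Nat using (ℕ; zero; suc; _+_)
open import Data.Bool using (Bool; true; false)
open import Data.Fin using (Fin; zero; suc; _<_)
open import Data.Product using (Σ; ∃; _×_; _,_)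
open import Relation.Binary.PropositionalEquality using (_≡_)

-- An m × n (0,1)-matrix: entry (i , j) is true iff it is a 1-entry.
Matrix : ℕ → ℕ → Set
Matrix m n = Fin m → Fin n → Bool

-- The 3 × 3 permutation matrix of 132: 1-entries at (1,1),(2,3),(3,2)
-- (0-indexed: (0,0),(1,2),(2,1)).
Q132 : Matrix 3 3
Q132 zero zero = true
Q132 (suc zero) (suc (suc zero)) = true
Q132 (suc (suc zero)) (suc zero) = true
Q132 _ _ = false

record Choose3 (n : ℕ) : Set where
  constructor choose3
  field
    a b c : Fin n
    a<b : a < b
    b<c : b < c

pick : ∀ {n} → Choose3 n → Fin 3 → Fin n
pick s zero = Choose3.a s
pick s (suc zero) = Choose3.b s
pick s (suc (suc zero)) = Choose3.c s

_∈₃_ : ∀ {n} → Fin n → Choose3 n → Set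
i ∈₃ s = ∃ λ k → pick s k ≡ i

submatrix : ∀ {n} → Matrix n n → Choose3 n → Choose3 n → Matrix 3 3
submatrix A R C k l = A (pick R k) (pick C l)

OccurrenceThrough : ∀ {n} → Matrix 3 3 → Matrix n n → Fin n → Fin n → Set
OccurrenceThrough P A i j =
  Σ (Choose3 _) λ R → Σ (Choose3 _) λ C →
    ((k l : Fin 3) → submatrix A R C k l ≡ P k l) × (i ∈₃ R) × (j ∈₃ C)

StronglyForcing : ∀ {n} → Matrix 3 3 → Matrix n n → Set
StronglyForcing P A = ∀ i j → A i j ≡ true → OccurrenceThrough P A i j

sumFin : ∀ n → (Fin n → ℕ) → ℕ
sumFin zero f = 0
sumFin (suc n) f = f zero + sumFin n (λ i → f (suc i))

toℕᵇ : Bool → ℕ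
toℕᵇ true = 1
toℕᵇ false = 0

ones : ∀ {n} → Matrix n n → ℕ
ones {n} A = sumFin n (λ i → sumFin n (λ j → toℕᵇ (A i j)))

{-# OPTIONS --safe #-}
module Submission where

-- Count zeros instead of ones. Every row has at least two zeros: a row with a 1
-- gets them from an occurrence through that 1. Fix a row i and charge the zero
-- at (r , j) to the 1-entry (i , j) whenever rows r and i share a zero column.
-- The other two rows of an occurrence through (i , j) both vanish in column j
-- and both share a zero with row i, so every 1 of row i is charged twice. A row
-- sharing a zero with row i has an uncharged zero there, and a row sharing none
-- is never charged; row i itself is never charged and has two zeros. Hence
-- zeros ≥ n + 2·ones(i) + 1. If some row i has at most two zeros this is at
-- least 3n − 3; otherwise every row has three zeros and there are 3n of them.

open import Defs
open import Data.Nat using (ℕ; _+_; _*_; _∸_; _≤_; zero; suc; z≤n; _≤?_)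
open import Relation.Binary.PropositionalEquality using (_≡_)
open import Data.Nat.Properties
open import Data.Nat.Tactic.RingSolver using (solve-∀)
open import Data.Bool using (true; false; not; _∧_)
open import Data.Bool.Properties using (∧-zeroʳ; ∧-inverseʳ; ¬-not) renaming (_≟_ to _≟ᵇ_)
open import Data.Fin.Base using (Fin; zero; suc)
open import Data.Fin.Patterns using (0F; 1F; 2F)
import Data.Fin.Properties as Finₚ
open import Data.Product using (∃; _×_; _,_)
open import Function using (_∘_)
open import Relation.Nullary using (Dec; yes; no; does; contradiction)
open import Relation.Nullary.Decidable using (_×-dec_; dec-true)
open import Relation.Binary.PropositionalEquality
  using (refl; sym; trans; cong; cong₂; subst; _≢_; module ≡-Reasoning)
open import Algebra.Properties.CommutativeSemigroup +-commutativeSemigroup using (xy∙z≈xz∙y)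
open import Algebra.Properties.CommutativeMonoid.Sum +-0-commutativeMonoid
  using (sum-syntax; sum-cong-≗; sum-replicate-zero; ∑-distrib-+; ∑-comm)

sumFin≡∑ : ∀ n (f : Fin n → ℕ) → sumFin n f ≡ ∑[ i < n ] f i
sumFin≡∑ zero    f = refl
sumFin≡∑ (suc n) f = cong (f zero +_) (sumFin≡∑ n (f ∘ suc))

∑-const : ∀ n c → ∑[ i < n ] c ≡ n * c
∑-const zero    c = refl
∑-const (suc n) c = cong (c +_) (∑-const n c)

∑-1 : ∀ n → ∑[ i < n ] 1 ≡ n
∑-1 n = trans (∑-const n 1) (*-identityʳ n)

∑-mono-≤ : ∀ {n} {f g : Fin n → ℕ} → (∀ i → f i ≤ g i) → ∑[ i < n ] f i ≤ ∑[ i < n ] g i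
∑-mono-≤ {zero}  f≤g = z≤n
∑-mono-≤ {suc n} f≤g = +-mono-≤ (f≤g zero) (∑-mono-≤ (f≤g ∘ suc))

∑-mono-≤-slack : ∀ {n} {f g : Fin n → ℕ} i {d} → (∀ k → f k ≤ g k) → f i + d ≤ g i →
                 ∑[ k < n ] f k + d ≤ ∑[ k < n ] g k
∑-mono-≤-slack {f = f} zero {d} f≤g slack =
  ≤-trans (≤-reflexive (xy∙z≈xz∙y (f zero) _ d)) (+-mono-≤ slack (∑-mono-≤ (f≤g ∘ suc)))
∑-mono-≤-slack {f = f} (suc i) {d} f≤g slack =
  ≤-trans (≤-reflexive (+-assoc (f zero) _ d)) (+-mono-≤ (f≤g zero) (∑-mono-≤-slack i (f≤g ∘ suc) slack))

∑-≥-point : ∀ {n} (f : Fin n → ℕ) i → f i ≤ ∑[ k < n ] f k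
∑-≥-point f zero    = m≤m+n (f zero) _
∑-≥-point f (suc i) = m≤n⇒m≤o+n (f zero) (∑-≥-point (f ∘ suc) i)

∑-≥-pair : ∀ {n} (f : Fin n → ℕ) {i j} → i ≢ j → f i + f j ≤ ∑[ k < n ] f k
∑-≥-pair f {zero}  {zero}  i≢j = contradiction refl i≢j
∑-≥-pair f {zero}  {suc j} _   = +-monoʳ-≤ (f zero) (∑-≥-point (f ∘ suc) j)
∑-≥-pair f {suc i} {zero}  _   =
  ≤-trans (≤-reflexive (+-comm (f (suc i)) (f zero))) (+-monoʳ-≤ (f zero) (∑-≥-point (f ∘ suc) i))
∑-≥-pair f {suc i} {suc j} i≢j = m≤n⇒m≤o+n (f zero) (∑-≥-pair (f ∘ suc) (i≢j ∘ cong suc))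

open Choose3 using (a<b; b<c)

pick-injective : ∀ {n} (s : Choose3 n) {k l} → pick s k ≡ pick s l → k ≡ l
pick-injective s {0F} {0F} _  = refl
pick-injective s {0F} {1F} eq = contradiction eq (Finₚ.<⇒≢ (a<b s))
pick-injective s {0F} {2F} eq = contradiction eq (Finₚ.<⇒≢ (Finₚ.<-trans (a<b s) (b<c s)))
pick-injective s {1F} {0F} eq = contradiction (sym eq) (Finₚ.<⇒≢ (a<b s))
pick-injective s {1F} {1F} _  = refl
pick-injective s {1F} {2F} eq = contradiction eq (Finₚ.<⇒≢ (b<c s))
pick-injective s {2F} {0F} eq = contradiction (sym eq) (Finₚ.<⇒≢ (Finₚ.<-trans (a<b s) (b<c s)))
pick-injective s {2F} {1F} eq = contradiction (sym eq) (Finₚ.<⇒≢ (b<c s))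
pick-injective s {2F} {2F} _  = refl

pick-≢ : ∀ {n} (s : Choose3 n) k l → k ≢ l → pick s k ≢ pick s l
pick-≢ s k l k≢l = k≢l ∘ pick-injective s

-- What an occurrence of Q132 through the 1-entry (i , j) provides:
-- b and c are its other two rows, y and z its other two columns.
record Frame {n} (A : Matrix n n) (i j : Fin n) : Set where
  field
    y z b c : Fin n
    y≢z : y ≢ z
    b≢c : b ≢ c
    Aiy : A i y ≡ false
    Aiz : A i z ≡ false
    Abj : A b j ≡ false
    Acj : A c j ≡ false
    Aby : A b y ≡ false
    Acz : A c z ≡ false

occurrence⇒frame : ∀ {n} {A : Matrix n n} {i j} →
                   A i j ≡ true → OccurrenceThrough Q132 A i j → Frame A i j
occurrence⇒frame {A = A} Aij (R , C , R×C≡Q , (k , refl) , (l , refl)) =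
  byPosition k l (trans (sym (R×C≡Q k l)) Aij)
  where
  byPosition : ∀ k l → Q132 k l ≡ true → Frame A (pick R k) (pick C l)
  byPosition 0F 0F _ = record
    { y = pick C 1F ; z = pick C 2F ; b = pick R 1F ; c = pick R 2F
    ; y≢z = pick-≢ C 1F 2F (λ ()) ; b≢c = pick-≢ R 1F 2F (λ ())
    ; Aiy = R×C≡Q 0F 1F ; Aiz = R×C≡Q 0F 2F ; Abj = R×C≡Q 1F 0F
    ; Acj = R×C≡Q 2F 0F ; Aby = R×C≡Q 1F 1F ; Acz = R×C≡Q 2F 2F }
  byPosition 1F 2F _ = record
    { y = pick C 1F ; z = pick C 0F ; b = pick R 0F ; c = pick R 2F
    ; y≢z = pick-≢ C 1F 0F (λ ()) ; b≢c = pick-≢ R 0F 2F (λ ())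
    ; Aiy = R×C≡Q 1F 1F ; Aiz = R×C≡Q 1F 0F ; Abj = R×C≡Q 0F 2F
    ; Acj = R×C≡Q 2F 2F ; Aby = R×C≡Q 0F 1F ; Acz = R×C≡Q 2F 0F }
  byPosition 2F 1F _ = record
    { y = pick C 2F ; z = pick C 0F ; b = pick R 0F ; c = pick R 1F
    ; y≢z = pick-≢ C 2F 0F (λ ()) ; b≢c = pick-≢ R 0F 1F (λ ())
    ; Aiy = R×C≡Q 2F 2F ; Aiz = R×C≡Q 2F 0F ; Abj = R×C≡Q 0F 1F
    ; Acj = R×C≡Q 1F 1F ; Aby = R×C≡Q 0F 2F ; Acz = R×C≡Q 1F 0F }
  byPosition 0F 1F ()
  byPosition 0F 2F ()
  byPosition 1F 0F ()
  byPosition 1F 1F ()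
  byPosition 2F 0F ()
  byPosition 2F 2F ()

toℕᵇ-+-not : ∀ x → toℕᵇ x + toℕᵇ (not x) ≡ 1
toℕᵇ-+-not true  = refl
toℕᵇ-+-not false = refl

toℕᵇ-∧-≤ʳ : ∀ x y → toℕᵇ (x ∧ y) ≤ toℕᵇ y
toℕᵇ-∧-≤ʳ true  y = ≤-refl
toℕᵇ-∧-≤ʳ false y = z≤n

toℕᵇ+toℕᵇ≤ : ∀ x {c} → (x ≡ true → 2 ≤ c) → toℕᵇ x + toℕᵇ x ≤ c
toℕᵇ+toℕᵇ≤ true  2≤c = 2≤c refl
toℕᵇ+toℕᵇ≤ false _   = z≤n

module _ {n} (A : Matrix n n) where

  onesInRow : Fin n → ℕ
  onesInRow r = ∑[ j < n ] toℕᵇ (A r j)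

  zerosInRow : Fin n → ℕ
  zerosInRow r = ∑[ j < n ] toℕᵇ (not (A r j))

  zeros : ℕ
  zeros = ∑[ r < n ] zerosInRow r

  onesInRow+zerosInRow : ∀ r → onesInRow r + zerosInRow r ≡ n
  onesInRow+zerosInRow r = begin
    onesInRow r + zerosInRow r                     ≡⟨ ∑-distrib-+ (toℕᵇ ∘ A r) (toℕᵇ ∘ not ∘ A r) ⟨
    ∑[ j < n ] (toℕᵇ (A r j) + toℕᵇ (not (A r j))) ≡⟨ sum-cong-≗ (λ j → toℕᵇ-+-not (A r j)) ⟩
    ∑[ j < n ] 1                                   ≡⟨ ∑-1 n ⟩
    n                                              ∎
    where open ≡-Reasoning

  ones+zeros : ones A + zeros ≡ n * n
  ones+zeros = begin
    ones A + zeros                                  ≡⟨ cong (_+ zeros) ones≡∑onesInRow ⟩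
    ∑[ r < n ] onesInRow r + zeros                  ≡⟨ ∑-distrib-+ onesInRow zerosInRow ⟨
    ∑[ r < n ] (onesInRow r + zerosInRow r)         ≡⟨ sum-cong-≗ onesInRow+zerosInRow ⟩
    ∑[ r < n ] n                                    ≡⟨ ∑-const n n ⟩
    n * n                                           ∎
    where
    open ≡-Reasoning
    ones≡∑onesInRow : ones A ≡ ∑[ r < n ] onesInRow r
    ones≡∑onesInRow = trans (sumFin≡∑ n _) (sum-cong-≗ λ r → sumFin≡∑ n (toℕᵇ ∘ A r))

  SharesZero : Fin n → Fin n → Set
  SharesZero i r = ∃ λ k → A i k ≡ false × A r k ≡ false

  shares? : ∀ i r → Dec (SharesZero i r)
  shares? i r = Finₚ.any? λ k → (A i k ≟ᵇ false) ×-dec (A r k ≟ᵇ false)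

  charged : Fin n → Fin n → Fin n → ℕ
  charged i r j = toℕᵇ (does (shares? i r) ∧ A i j ∧ not (A r j))

  charged-diagonal : ∀ i j → charged i i j ≡ 0
  charged-diagonal i j = cong toℕᵇ (trans (cong (does (shares? i i) ∧_) (∧-inverseʳ (A i j))) (∧-zeroʳ _))

  charged-one : ∀ {i r j} → SharesZero i r → A i j ≡ true → A r j ≡ false → charged i r j ≡ 1
  charged-one {i} {r} sh Aij Arj rewrite dec-true (shares? i r) sh | Aij | Arj = refl

module _ {n} {A : Matrix n n} (forcing : StronglyForcing Q132 A) where

  frameAt : ∀ {i j} → A i j ≡ true → Frame A i j
  frameAt Aij = occurrence⇒frame Aij (forcing _ _ Aij)

  2≤zerosInRow : 2 ≤ n → ∀ r → 2 ≤ zerosInRow A r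
  2≤zerosInRow 2≤n r with Finₚ.any? (λ j → A r j ≟ᵇ true)
  ... | yes (j , Arj) = subst (_≤ zerosInRow A r) (cong₂ _+_ (countsZero Aiy) (countsZero Aiz))
                          (∑-≥-pair (toℕᵇ ∘ not ∘ A r) y≢z)
    where
    open Frame (frameAt Arj)
    countsZero : ∀ {x} → x ≡ false → toℕᵇ (not x) ≡ 1
    countsZero refl = refl
  ... | no noOne = subst (2 ≤_) (sym rowOfZeros) 2≤n
    where
    rowOfZeros : zerosInRow A r ≡ n
    rowOfZeros = begin
      zerosInRow A r ≡⟨ sum-cong-≗ (λ j → cong (toℕᵇ ∘ not) (¬-not (noOne ∘ (j ,_)))) ⟩
      ∑[ j < n ] 1   ≡⟨ ∑-1 n ⟩
      n              ∎
      where open ≡-Reasoning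

  module _ (2≤n : 2 ≤ n) (i : Fin n) where

    1+charged≤zerosInRow : ∀ r → 1 + ∑[ j < n ] charged A i r j ≤ zerosInRow A r
    1+charged≤zerosInRow r = bound (shares? A i r)
      where
      bound : (s : Dec (SharesZero A i r)) →
              1 + ∑[ j < n ] toℕᵇ (does s ∧ A i j ∧ not (A r j)) ≤ zerosInRow A r
      bound (yes (k , Aik , Ark)) = ≤-trans (≤-reflexive (+-comm 1 _))
        (∑-mono-≤-slack k (λ j → toℕᵇ-∧-≤ʳ (A i j) (not (A r j))) slack)
        where
        slack : toℕᵇ (A i k ∧ not (A r k)) + 1 ≤ toℕᵇ (not (A r k))
        slack rewrite Aik | Ark = ≤-refl
      bound (no _) = ≤-trans (≤-reflexive (cong suc (sum-replicate-zero n))) (<⇒≤ (2≤zerosInRow 2≤n r))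

    2≤charged : ∀ {j} → A i j ≡ true → 2 ≤ ∑[ r < n ] charged A i r j
    2≤charged {j} Aij = subst (_≤ ∑[ r < n ] charged A i r j)
      (cong₂ _+_ (charged-one A (y , Aiy , Aby) Aij Abj) (charged-one A (z , Aiz , Acz) Aij Acj))
      (∑-≥-pair (λ r → charged A i r j) b≢c)
      where open Frame (frameAt Aij)

    n+2*onesInRow+1≤zeros : n + 2 * onesInRow A i + 1 ≤ zeros A
    n+2*onesInRow+1≤zeros = begin
      n + 2 * onesInRow A i + 1                         ≤⟨ +-monoˡ-≤ 1 (+-monoʳ-≤ n totalCharge) ⟩
      n + ∑[ r < n ] ∑[ j < n ] charged A i r j + 1     ≡⟨ cong (_+ 1) (sym rowsPlusCharge) ⟩
      ∑[ r < n ] (1 + ∑[ j < n ] charged A i r j) + 1   ≤⟨ ∑-mono-≤-slack i 1+charged≤zerosInRow slackAtI ⟩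
      zeros A                                           ∎
      where
      open ≤-Reasoning
      totalCharge : 2 * onesInRow A i ≤ ∑[ r < n ] ∑[ j < n ] charged A i r j
      totalCharge = begin
        2 * onesInRow A i                                 ≡⟨ cong (onesInRow A i +_) (+-identityʳ (onesInRow A i)) ⟩
        onesInRow A i + onesInRow A i                     ≡⟨ ∑-distrib-+ (toℕᵇ ∘ A i) (toℕᵇ ∘ A i) ⟨
        ∑[ j < n ] (toℕᵇ (A i j) + toℕᵇ (A i j))          ≤⟨ ∑-mono-≤ (λ j → toℕᵇ+toℕᵇ≤ (A i j) 2≤charged) ⟩
        ∑[ j < n ] ∑[ r < n ] charged A i r j             ≡⟨ ∑-comm (λ j r → charged A i r j) ⟩
        ∑[ r < n ] ∑[ j < n ] charged A i r j             ∎
      rowsPlusCharge : ∑[ r < n ] (1 + ∑[ j < n ] charged A i r j) ≡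
                       n + ∑[ r < n ] ∑[ j < n ] charged A i r j
      rowsPlusCharge = trans (∑-distrib-+ (λ _ → 1) (λ r → ∑[ j < n ] charged A i r j))
                             (cong (_+ ∑[ r < n ] ∑[ j < n ] charged A i r j) (∑-1 n))
      slackAtI : 1 + ∑[ j < n ] charged A i i j + 1 ≤ zerosInRow A i
      slackAtI = ≤-trans (≤-reflexive noChargeAtI) (2≤zerosInRow 2≤n i)
        where
        noChargeAtI : 1 + ∑[ j < n ] charged A i i j + 1 ≡ 2
        noChargeAtI = cong (λ c → 1 + c + 1)
          (trans (sum-cong-≗ (charged-diagonal A i)) (sum-replicate-zero n))

  3*n≤zeros+3 : 3 ≤ n → 3 * n ≤ zeros A + 3
  3*n≤zeros+3 3≤n with Finₚ.any? (λ r → zerosInRow A r ≤? 2)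
  ... | yes (i , zerosᵢ≤2) = begin
    3 * n                                    ≡⟨ 3*n≡n+n+n n ⟩
    n + n + n                                ≤⟨ +-mono-≤ (+-monoʳ-≤ n n≤onesᵢ+2) n≤onesᵢ+2 ⟩
    n + (onesᵢ + 2) + (onesᵢ + 2)            ≡⟨ rearrange n onesᵢ ⟩
    n + 2 * onesᵢ + 1 + 3                    ≤⟨ +-monoˡ-≤ 3 (n+2*onesInRow+1≤zeros (<⇒≤ 3≤n) i) ⟩
    zeros A + 3                              ∎
    where
    open ≤-Reasoning
    onesᵢ : ℕ
    onesᵢ = onesInRow A i
    n≤onesᵢ+2 : n ≤ onesᵢ + 2
    n≤onesᵢ+2 = subst (_≤ onesᵢ + 2) (onesInRow+zerosInRow A i) (+-monoʳ-≤ onesᵢ zerosᵢ≤2)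
    3*n≡n+n+n : ∀ n → 3 * n ≡ n + n + n
    3*n≡n+n+n = solve-∀
    rearrange : ∀ n o → n + (o + 2) + (o + 2) ≡ n + 2 * o + 1 + 3
    rearrange = solve-∀
  ... | no noSmallRow = begin
    3 * n                    ≡⟨ *-comm 3 n ⟩
    n * 3                    ≡⟨ ∑-const n 3 ⟨
    ∑[ r < n ] 3             ≤⟨ ∑-mono-≤ (λ r → ≰⇒> (noSmallRow ∘ (r ,_))) ⟩
    zeros A                  ≤⟨ m≤m+n (zeros A) 3 ⟩
    zeros A + 3              ∎
    where open ≤-Reasoning

lemma7 : (n : ℕ) → 3 ≤ n → (A : Matrix n n) → StronglyForcing Q132 A →
    ones A ≤ (n * n ∸ 3 * n) + 3
lemma7 n 3≤n A forcing =
  ≤-trans (m+n≤o⇒m≤o∸n (ones A) ones+3*n≤n*n+3) (≤-reflexive (+-∸-comm 3 (*-monoˡ-≤ n 3≤n)))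
  where
  open ≤-Reasoning
  ones+3*n≤n*n+3 : ones A + 3 * n ≤ n * n + 3
  ones+3*n≤n*n+3 = begin
    ones A + 3 * n            ≤⟨ +-monoʳ-≤ (ones A) (3*n≤zeros+3 forcing 3≤n) ⟩
    ones A + (zeros A + 3)    ≡⟨ +-assoc (ones A) (zeros A) 3 ⟨
    ones A + zeros A + 3      ≡⟨ cong (_+ 3) (ones+zeros A) ⟩
    n * n + 3                 ∎
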